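{- Let $T=(V,E)$ be a tree with $m=|E|\geq 1$ edges satisfying $\sum_{e_{uv}\in E}(d_u+d_v)=4m$. Then for every integer $s\geq 1$, the $s$-th subdivision tree $T_s$ of $T$ is neutral.
   Context: $d_u$ denotes the degree of vertex $u$ and $e_{uv}$ the edge with endpoints $u,v$. The $s$-th subdivision graph $G_s$ of a graph $G$ is obtained by inserting $s$ new vertices into each edge of $G$ (i.e. replacing each edge by a path with $s$ internal new vertices). For a simple connected graph $G=(V,E)$ with $m\geq1$ edges, the assortativity coefficient is $$r=\frac{m^{ -1}\sum_{e_{uv}\in E} d_{u}d_{v}-\Big[m^{ -1}\sum_{e_{uv}\in E} \tfrac{1}{2}(d_{u}+d_{v})\Big]^{2}}{m^{ -1}\sum_{e_{uv}\in E} \tfrac{1}{2}(d^{2}_{u}+d^{2}_{v})-\Big[m^{ -1}\sum_{e_{uv}\in E} \tfrac{1}{2}(d_{u}+d_{v})\Big]^{2}},$$ and $G$ is called neutral if $r$ is well defined (nonzero denominator) and $r=0$. -}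

module Defs where

open import Data.Nat as ℕ using (ℕ; zero; suc)
open import Data.Fin using (Fin; zero; suc)
open import Data.List using (List; []; _∷_; length; map; concatMap; tabulate; lookup)
open import Data.List.Membership.Propositional using (_∈_)
open import Data.List.Relation.Unary.All using (All)
open import Data.Product using (_×_; _,_; proj₁; proj₂; Σ)
open import Data.Sum using (_⊎_; inj₁; inj₂)
import Data.Sum.Properties as SumP
import Data.Product.Properties as ProdP
import Data.Fin.Properties as FinP
open import Data.Integer using (ℤ; +_)
open import Data.Rational as ℚ using (ℚ; 0ℚ; _/_)
open import Relation.Binary.Definitions using (DecidableEquality)
open import Relation.Binary.PropositionalEquality using (_≡_; _≢_)
open import Relation.Binary.Construct.Closure.ReflexiveTransitive using (Star)
open import Relation.Nullary.Decidable using (does)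
open import Data.Bool using (if_then_else_)
open import Data.Nat.ListAction using () renaming (sum to sumℕ)

module _ {V : Set} (_≟_ : DecidableEquality V) where

  deg : List (V × V) → V → ℕ
  deg [] u = 0
  deg ((a , b) ∷ es) u =
    (if does (a ≟ u) then 1 else 0) ℕ.+ (if does (b ≟ u) then 1 else 0) ℕ.+ deg es u

  module _ (E : List (V × V)) where
    d : V → ℕ
    d = deg E

    sumProd : ℕ
    sumProd = sumℕ (map (λ e → d (proj₁ e) ℕ.* d (proj₂ e)) E)

    sumEnds : ℕ
    sumEnds = sumℕ (map (λ e → d (proj₁ e) ℕ.+ d (proj₂ e)) E)

    sumSq : ℕ
    sumSq = sumℕ (map (λ e → d (proj₁ e) ℕ.* d (proj₁ e) ℕ.+ d (proj₂ e) ℕ.* d (proj₂ e)) E)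

    -- m⁻¹ as a rational (only used when m ≥ 1)
    invm : ℚ
    invm with length E
    ... | zero = 0ℚ
    ... | suc k = + 1 / suc k

    half : ℚ
    half = + 1 / 2

    meanEnds : ℚ
    meanEnds = invm ℚ.* (half ℚ.* (+ sumEnds / 1))

    numer : ℚ
    numer = invm ℚ.* (+ sumProd / 1) ℚ.- meanEnds ℚ.* meanEnds

    denom : ℚ
    denom = invm ℚ.* (half ℚ.* (+ sumSq / 1)) ℚ.- meanEnds ℚ.* meanEnds

    assortativity : .{{_ : ℚ.NonZero denom}} → ℚ
    assortativity = numer ℚ.÷ denom

    Neutral : Set
    Neutral = (1 ℕ.≤ length E) × Σ (ℚ.NonZero denom) (λ nz → assortativity {{nz}} ≡ 0ℚ)

module _ {n : ℕ} (E : List (Fin n × Fin n)) where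

  Adj : Fin n → Fin n → Set
  Adj u v = ((u , v) ∈ E) ⊎ ((v , u) ∈ E)

  data NoMultiEdges : List (Fin n × Fin n) → Set where
    []  : NoMultiEdges []
    _∷_ : ∀ {a b es} → All (λ e → (e ≢ (a , b)) × (e ≢ (b , a))) es →
          NoMultiEdges es → NoMultiEdges ((a , b) ∷ es)

  IsSimple : Set
  IsSimple = All (λ e → proj₁ e ≢ proj₂ e) E × NoMultiEdges E

  Connected : Set
  Connected = ∀ u v → Star Adj u v

  IsTree : Set
  IsTree = IsSimple × Connected × (length E ℕ.+ 1 ≡ n)

-- s-th subdivision.  The vertex set of T_s is V ⊎ (Fin m × Fin s):
-- the internal vertices of the path replacing the i-th edge are (i , j).

SubV : ℕ → ℕ → ℕ → Set
SubV n m s = Fin n ⊎ (Fin m × Fin s)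

subV-≟ : ∀ {n m s} → DecidableEquality (SubV n m s)
subV-≟ = SumP.≡-dec FinP._≟_ (ProdP.≡-dec FinP._≟_ FinP._≟_)

chain : {W : Set} (k : ℕ) → (Fin (suc k) → W) → W → List (W × W)
chain zero f b = (f zero , b) ∷ []
chain (suc k) f b = (f zero , f (suc zero)) ∷ chain k (λ j → f (suc j)) b

subdivision : ∀ {n} (s : ℕ) (E : List (Fin n × Fin n)) → List (SubV n (length E) s × SubV n (length E) s)
subdivision zero E = map (λ e → inj₁ (proj₁ e) , inj₁ (proj₂ e)) E
subdivision (suc k) E = concatMap edgePath (tabulate (λ i → i))
  where
  edgePath : Fin (length E) → _
  edgePath i = (inj₁ (proj₁ (lookup E i)) , inj₂ (i , zero))
             ∷ chain k (λ j → inj₂ (i , j)) (inj₁ (proj₂ (lookup E i)))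

{-# OPTIONS --safe #-}
module Submission where

-- In Tₛ every new vertex has degree 2 and every old vertex keeps its degree, so the path
-- replacing an edge e_uv contributes d_u + d_v + 4s to Σ (d_x + d_y), 2 (d_u + d_v) + 4 (s - 1)
-- to Σ d_x d_y and d_u² + d_v² + 8s to Σ (d_x² + d_y²).  With Σ (d_u + d_v) = 4m and M = m (s + 1)
-- edges, the first two sums both equal 4M: the mean end-degree is 2 and the numerator 4 - 2² of r
-- vanishes.  The denominator is (Σ_v d_v³ - 8m) / 2M, which is positive: summing
-- (d_v - 1)² (d_v - 2) ≥ 0 over the m + 1 vertices of T, with Σ_v d_v = 2m and Σ_v d_v² = 4m,
-- gives Σ_v d_v³ ≥ 8m + 2.

open import Defs
open import Data.Nat as ℕ using (ℕ; zero; suc; _+_; _*_; _≤_; _<_; s≤s; z≤n)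
import Data.Nat.Properties as ℕP
open import Data.Nat.Tactic.RingSolver using (solve-∀)
open import Data.Nat.ListAction using (sum)
open import Data.Nat.ListAction.Properties using (sum-++)
open import Algebra.Properties.Semiring.Sum ℕP.+-*-semiring
  using (sum-syntax; sum-cong-≗; sum-replicate-zero; ∑-distrib-+; *-distribˡ-sum)
import Data.Integer as ℤ
import Data.Integer.Properties as ℤP
open import Data.Rational as ℚ using (ℚ; 0ℚ; 1ℚ; _/_; fromℚᵘ)
import Data.Rational.Properties as ℚP
open import Data.Rational.Solver using (module +-*-Solver)
open import Data.Rational.Unnormalised as ℚᵘ using (mkℚᵘ)
import Data.Rational.Unnormalised.Properties as ℚᵘP
open import Data.Fin using (Fin; zero; suc)
open import Data.Fin.Properties using (_≟_)
open import Data.List using (List; []; _∷_; _++_; length; map; concatMap; tabulate; lookup)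
open import Data.List.Properties using (map-++)
open import Data.List.Membership.Propositional using (_∈_)
open import Data.List.Relation.Unary.Any using (here; there)
open import Data.Product using (_×_; _,_; proj₁; proj₂)
open import Data.Sum using (inj₁; inj₂)
open import Data.Bool using (if_then_else_)
open import Data.Empty using (⊥-elim)
open import Function using (id; _∘_)
open import Relation.Nullary using (yes; no; does)
open import Relation.Nullary.Decidable using (dec-true)
open import Relation.Binary.Definitions using (DecidableEquality)
open import Relation.Binary.PropositionalEquality
open import Relation.Binary.Construct.Closure.ReflexiveTransitive using (Star; ε; _◅_)

∑-const : ∀ n c → ∑[ i < n ] c ≡ n * c
∑-const zero    c = refl
∑-const (suc n) c = cong (c +_) (∑-const n c)

∑-mono-≤ : ∀ {n} {f g : Fin n → ℕ} → (∀ i → f i ≤ g i) → ∑[ i < n ] f i ≤ ∑[ i < n ] g i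
∑-mono-≤ {zero}  f≤g = z≤n
∑-mono-≤ {suc n} f≤g = ℕP.+-mono-≤ (f≤g zero) (∑-mono-≤ (f≤g ∘ suc))

sum-map-const : ∀ {A : Set} c (xs : List A) → sum (map (λ _ → c) xs) ≡ length xs * c
sum-map-const c []       = refl
sum-map-const c (x ∷ xs) = cong (c +_) (sum-map-const c xs)

sum-map-* : ∀ {A : Set} c (f : A → ℕ) (xs : List A) → sum (map (λ x → c * f x) xs) ≡ c * sum (map f xs)
sum-map-* c f []       = sym (ℕP.*-zeroʳ c)
sum-map-* c f (x ∷ xs) = trans (cong (c * f x +_) (sum-map-* c f xs)) (sym (ℕP.*-distribˡ-+ c (f x) _))

sum-map≡∑-lookup : ∀ {A : Set} (f : A → ℕ) (xs : List A) → sum (map f xs) ≡ ∑[ i < length xs ] f (lookup xs i)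
sum-map≡∑-lookup f []       = refl
sum-map≡∑-lookup f (x ∷ xs) = cong (f x +_) (sum-map≡∑-lookup f xs)

sum-map-concatMap-tabulate : ∀ {A B : Set} {m} (f : B → ℕ) (P : A → List B) (g : Fin m → A) →
  sum (map f (concatMap P (tabulate g))) ≡ ∑[ i < m ] sum (map f (P (g i)))
sum-map-concatMap-tabulate {m = zero}  f P g = refl
sum-map-concatMap-tabulate {m = suc m} f P g = begin
  sum (map f (P (g zero) ++ concatMap P (tabulate (g ∘ suc))))
    ≡⟨ cong sum (map-++ f (P (g zero)) _) ⟩
  sum (map f (P (g zero)) ++ map f (concatMap P (tabulate (g ∘ suc))))
    ≡⟨ sum-++ (map f (P (g zero))) _ ⟩
  sum (map f (P (g zero))) + sum (map f (concatMap P (tabulate (g ∘ suc))))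
    ≡⟨ cong (sum (map f (P (g zero))) +_) (sum-map-concatMap-tabulate f P (g ∘ suc)) ⟩
  sum (map f (P (g zero))) + ∑[ i < m ] sum (map f (P (g (suc i)))) ∎
  where open ≡-Reasoning

module _ {A : Set} (_≟ᴬ_ : DecidableEquality A) where

  δ : A → A → ℕ
  δ x y = if does (x ≟ᴬ y) then 1 else 0

  δ-refl : ∀ x → δ x x ≡ 1
  δ-refl x = cong (λ t → if t then 1 else 0) (dec-true (x ≟ᴬ x) refl)

  deg-++ : ∀ (xs ys : List (A × A)) w → deg _≟ᴬ_ (xs ++ ys) w ≡ deg _≟ᴬ_ xs w + deg _≟ᴬ_ ys w
  deg-++ []             ys w = refl
  deg-++ ((a , b) ∷ xs) ys w =
    trans (cong (δ a w + δ b w +_) (deg-++ xs ys w)) (sym (ℕP.+-assoc (δ a w + δ b w) _ _))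

  deg-concatMap-tabulate : ∀ {B : Set} {m} (P : B → List (A × A)) (g : Fin m → B) w →
    deg _≟ᴬ_ (concatMap P (tabulate g)) w ≡ ∑[ i < m ] deg _≟ᴬ_ (P (g i)) w
  deg-concatMap-tabulate {m = zero}  P g w = refl
  deg-concatMap-tabulate {m = suc m} P g w =
    trans (deg-++ (P (g zero)) _ w) (cong (deg _≟ᴬ_ (P (g zero)) w +_) (deg-concatMap-tabulate P (g ∘ suc) w))

  deg≡∑-lookup : ∀ (E : List (A × A)) w →
    deg _≟ᴬ_ E w ≡ ∑[ i < length E ] (δ (proj₁ (lookup E i)) w + δ (proj₂ (lookup E i)) w)
  deg≡∑-lookup []             w = refl
  deg≡∑-lookup ((a , b) ∷ es) w = cong (δ a w + δ b w +_) (deg≡∑-lookup es w)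

  ∈⇒deg-positive : ∀ {E a b} → (a , b) ∈ E → 1 ≤ deg _≟ᴬ_ E a × 1 ≤ deg _≟ᴬ_ E b
  ∈⇒deg-positive {(a , b) ∷ es} (here refl) = a-end , b-end
    where
    open ℕP.≤-Reasoning
    a-end : 1 ≤ δ a a + δ b a + deg _≟ᴬ_ es a
    a-end = begin
      1                                ≡⟨ sym (δ-refl a) ⟩
      δ a a                            ≤⟨ ℕP.m≤m+n (δ a a) (δ b a) ⟩
      δ a a + δ b a                    ≤⟨ ℕP.m≤m+n _ (deg _≟ᴬ_ es a) ⟩
      δ a a + δ b a + deg _≟ᴬ_ es a    ∎
    b-end : 1 ≤ δ a b + δ b b + deg _≟ᴬ_ es b
    b-end = begin
      1                                ≡⟨ sym (δ-refl b) ⟩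
      δ b b                            ≤⟨ ℕP.m≤n+m (δ b b) (δ a b) ⟩
      δ a b + δ b b                    ≤⟨ ℕP.m≤m+n _ (deg _≟ᴬ_ es b) ⟩
      δ a b + δ b b + deg _≟ᴬ_ es b    ∎
  ∈⇒deg-positive {(x , y) ∷ es} (there p) =
    ℕP.≤-trans (proj₁ (∈⇒deg-positive p)) (ℕP.m≤n+m _ (δ x _ + δ y _)) ,
    ℕP.≤-trans (proj₂ (∈⇒deg-positive p)) (ℕP.m≤n+m _ (δ x _ + δ y _))

  deg-chain : ∀ k (f : Fin (suc k) → A) b w → δ b w ≡ 0 →
    δ (f zero) w + deg _≟ᴬ_ (chain k f b) w ≡ 2 * ∑[ j < suc k ] δ (f j) w
  deg-chain zero f b w δbw≡0 rewrite δbw≡0 = regroup (δ (f zero) w)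
    where
    regroup : ∀ x → x + ((x + 0) + 0) ≡ 2 * (x + 0)
    regroup = solve-∀
  deg-chain (suc k) f b w δbw≡0 = begin
    x + ((x + δ (f (suc zero)) w) + deg _≟ᴬ_ (chain k (f ∘ suc) b) w)
      ≡⟨ regroup x _ _ ⟩
    (x + x) + (δ (f (suc zero)) w + deg _≟ᴬ_ (chain k (f ∘ suc) b) w)
      ≡⟨ cong ((x + x) +_) (deg-chain k (f ∘ suc) b w δbw≡0) ⟩
    (x + x) + 2 * ∑[ j < suc k ] δ (f (suc j)) w
      ≡⟨ factor x _ ⟩
    2 * (x + ∑[ j < suc k ] δ (f (suc j)) w) ∎
    where
    open ≡-Reasoning
    x = δ (f zero) w
    regroup : ∀ x y z → x + ((x + y) + z) ≡ (x + x) + (y + z)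
    regroup = solve-∀
    factor : ∀ x s → (x + x) + 2 * s ≡ 2 * (x + s)
    factor = solve-∀

∑-δ-* : ∀ {n} (a : Fin n) (f : Fin n → ℕ) → ∑[ v < n ] (δ _≟_ a v * f v) ≡ f a
∑-δ-* {suc n} zero    f = trans (cong₂ _+_ (ℕP.+-identityʳ (f zero)) (sum-replicate-zero n)) (ℕP.+-identityʳ (f zero))
∑-δ-* {suc n} (suc a) f = ∑-δ-* a (f ∘ suc)

∑-δ : ∀ {n} (a : Fin n) → ∑[ v < n ] δ _≟_ v a ≡ 1
∑-δ {suc n} zero    = cong suc (sum-replicate-zero n)
∑-δ {suc n} (suc a) = ∑-δ a

handshake : ∀ {n} (E : List (Fin n × Fin n)) (f : Fin n → ℕ) →
  ∑[ v < n ] (deg _≟_ E v * f v) ≡ sum (map (λ e → f (proj₁ e) + f (proj₂ e)) E)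
handshake {n} []             f = sum-replicate-zero n
handshake {n} ((a , b) ∷ es) f = begin
  ∑[ v < n ] ((δ _≟_ a v + δ _≟_ b v + deg _≟_ es v) * f v)
    ≡⟨ sum-cong-≗ (λ v → distrib (δ _≟_ a v) (δ _≟_ b v) (deg _≟_ es v) (f v)) ⟩
  ∑[ v < n ] (δ _≟_ a v * f v + δ _≟_ b v * f v + deg _≟_ es v * f v)
    ≡⟨ ∑-distrib-+ (λ v → δ _≟_ a v * f v + δ _≟_ b v * f v) (λ v → deg _≟_ es v * f v) ⟩
  ∑[ v < n ] (δ _≟_ a v * f v + δ _≟_ b v * f v) + ∑[ v < n ] (deg _≟_ es v * f v)
    ≡⟨ cong₂ _+_ (∑-distrib-+ (λ v → δ _≟_ a v * f v) (λ v → δ _≟_ b v * f v)) refl ⟩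
  ∑[ v < n ] (δ _≟_ a v * f v) + ∑[ v < n ] (δ _≟_ b v * f v) + ∑[ v < n ] (deg _≟_ es v * f v)
    ≡⟨ cong₂ _+_ (cong₂ _+_ (∑-δ-* a f) (∑-δ-* b f)) (handshake es f) ⟩
  f a + f b + sum (map (λ e → f (proj₁ e) + f (proj₂ e)) es) ∎
  where
  open ≡-Reasoning
  distrib : ∀ x y z w → (x + y + z) * w ≡ x * w + y * w + z * w
  distrib = solve-∀

Star⇒deg-positive : ∀ {n} (E : List (Fin n × Fin n)) {u v} → u ≢ v → Star (Adj E) u v → 1 ≤ deg _≟_ E u
Star⇒deg-positive E u≢v ε              = ⊥-elim (u≢v refl)
Star⇒deg-positive E u≢v (inj₁ uv ◅ _) = proj₁ (∈⇒deg-positive _≟_ uv)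
Star⇒deg-positive E u≢v (inj₂ vu ◅ _) = proj₂ (∈⇒deg-positive _≟_ vu)

Connected⇒deg-positive : ∀ {n} (E : List (Fin n × Fin n)) → Connected E → 2 ≤ n → ∀ v → 1 ≤ deg _≟_ E v
Connected⇒deg-positive E conn (s≤s (s≤s z≤n)) zero    = Star⇒deg-positive E (λ ()) (conn zero (suc zero))
Connected⇒deg-positive E conn (s≤s (s≤s z≤n)) (suc v) = Star⇒deg-positive E (λ ()) (conn (suc v) zero)

∑-deg : ∀ {n} (E : List (Fin n × Fin n)) → ∑[ v < n ] deg _≟_ E v ≡ length E * 2
∑-deg E = trans (sum-cong-≗ (λ v → sym (ℕP.*-identityʳ (deg _≟_ E v))))
                (trans (handshake E (λ _ → 1)) (sum-map-const 2 E))

-- x³ - 4x² + 5x - 2 = (x - 1)² (x - 2)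
cubic-bound : ∀ x → 1 ≤ x → 4 * (x * x) + 2 ≤ x * (x * x) + 5 * x
cubic-bound (suc zero)    _ = ℕP.≤-refl
cubic-bound (suc (suc y)) _ = ℕP.≤-trans (ℕP.m≤m+n _ (y * ((1 + y) * (1 + y)))) (ℕP.≤-reflexive (expand y))
  where
  expand : ∀ y → 4 * ((2 + y) * (2 + y)) + 2 + y * ((1 + y) * (1 + y)) ≡ (2 + y) * ((2 + y) * (2 + y)) + 5 * (2 + y)
  expand = solve-∀

sumSq-lower-bound : ∀ {n} (E : List (Fin n × Fin n)) → (∀ v → 1 ≤ deg _≟_ E v) →
  4 * sumEnds _≟_ E + n * 2 ≤ sumSq _≟_ E + 5 * (length E * 2)
sumSq-lower-bound {n} E deg≥1 = begin
  4 * sumEnds _≟_ E + n * 2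
    ≡⟨ sym (cong₂ _+_ (cong (4 *_) (handshake E D)) (∑-const n 2)) ⟩
  4 * ∑[ v < n ] (D v * D v) + ∑[ v < n ] 2
    ≡⟨ cong (_+ ∑[ v < n ] 2) (*-distribˡ-sum 4 (λ v → D v * D v)) ⟩
  ∑[ v < n ] (4 * (D v * D v)) + ∑[ v < n ] 2
    ≡⟨ sym (∑-distrib-+ (λ v → 4 * (D v * D v)) (λ _ → 2)) ⟩
  ∑[ v < n ] (4 * (D v * D v) + 2)
    ≤⟨ ∑-mono-≤ (λ v → cubic-bound (D v) (deg≥1 v)) ⟩
  ∑[ v < n ] (D v * (D v * D v) + 5 * D v)
    ≡⟨ ∑-distrib-+ (λ v → D v * (D v * D v)) (λ v → 5 * D v) ⟩
  ∑[ v < n ] (D v * (D v * D v)) + ∑[ v < n ] (5 * D v)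
    ≡⟨ cong₂ _+_ (handshake E (λ v → D v * D v)) (trans (sym (*-distribˡ-sum 5 D)) (cong (5 *_) (∑-deg E))) ⟩
  sumSq _≟_ E + 5 * (length E * 2) ∎
  where
  open ℕP.≤-Reasoning
  D = deg _≟_ E

tree-sumSq-bound : ∀ {n} (E : List (Fin n × Fin n)) → Connected E → length E + 1 ≡ n → 1 ≤ length E →
  sumEnds _≟_ E ≡ 4 * length E → 8 * length E < sumSq _≟_ E
tree-sumSq-bound {n} E conn m+1≡n 1≤m ends =
  ℕP.<-≤-trans (ℕP.m<m+n (8 * m) (s≤s z≤n)) (ℕP.+-cancelʳ-≤ (5 * (m * 2)) _ _ bound)
  where
  open ℕP.≤-Reasoning
  m = length E
  2≤n : 2 ≤ n
  2≤n = subst (2 ≤_) m+1≡n (ℕP.+-monoˡ-≤ 1 1≤m)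
  regroup : ∀ m → 4 * (4 * m) + (m + 1) * 2 ≡ (8 * m + 2) + 5 * (m * 2)
  regroup = solve-∀
  bound : (8 * m + 2) + 5 * (m * 2) ≤ sumSq _≟_ E + 5 * (m * 2)
  bound = begin
    (8 * m + 2) + 5 * (m * 2)      ≡⟨ sym (regroup m) ⟩
    4 * (4 * m) + (m + 1) * 2      ≡⟨ cong₂ (λ s k → 4 * s + k * 2) (sym ends) m+1≡n ⟩
    4 * sumEnds _≟_ E + n * 2      ≤⟨ sumSq-lower-bound E (Connected⇒deg-positive E conn 2≤n) ⟩
    sumSq _≟_ E + 5 * (m * 2)      ∎

module Subdivision {n : ℕ} (E : List (Fin n × Fin n)) (k : ℕ) where

  private
    m = length E
    a b : Fin m → Fin n
    a i = proj₁ (lookup E i)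
    b i = proj₂ (lookup E i)
    D = deg _≟_ E
    Eₛ = subdivision (suc k) E
    Dₛ = deg subV-≟ Eₛ

    -- definitionally the edges that subdivision puts in place of the i-th edge of E
    path : Fin m → List (SubV n m (suc k) × SubV n m (suc k))
    path i = (inj₁ (a i) , inj₂ (i , zero)) ∷ chain k (λ j → inj₂ (i , j)) (inj₁ (b i))

    deg-chain-old : ∀ {s} k′ (c : Fin (suc k′) → Fin m × Fin s) u v →
      deg (subV-≟ {n}) (chain k′ (inj₂ ∘ c) (inj₁ u)) (inj₁ v) ≡ δ _≟_ u v
    deg-chain-old zero     c u v = ℕP.+-identityʳ (δ _≟_ u v)
    deg-chain-old (suc k′) c u v = deg-chain-old k′ (c ∘ suc) u v

    ∑-δ-inner : ∀ {s} (i i₀ : Fin m) (j₀ : Fin s) →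
      ∑[ j < s ] δ (subV-≟ {n}) (inj₂ (i , j)) (inj₂ (i₀ , j₀)) ≡ δ _≟_ i i₀
    ∑-δ-inner {s} i i₀ j₀ with i ≟ i₀
    ... | no _     = sum-replicate-zero s
    ... | yes refl = ∑-δ j₀

  deg-old : ∀ v → Dₛ (inj₁ v) ≡ D v
  deg-old v = begin
    Dₛ (inj₁ v)
      ≡⟨ deg-concatMap-tabulate subV-≟ path id (inj₁ v) ⟩
    ∑[ i < m ] deg subV-≟ (path i) (inj₁ v)
      ≡⟨ sum-cong-≗ (λ i → cong₂ _+_ (ℕP.+-identityʳ (δ _≟_ (a i) v)) (deg-chain-old k (i ,_) (b i) v)) ⟩
    ∑[ i < m ] (δ _≟_ (a i) v + δ _≟_ (b i) v)
      ≡⟨ sym (deg≡∑-lookup _≟_ E v) ⟩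
    D v ∎
    where open ≡-Reasoning

  deg-new : ∀ p → Dₛ (inj₂ p) ≡ 2
  deg-new (i₀ , j₀) = begin
    Dₛ w
      ≡⟨ deg-concatMap-tabulate subV-≟ path id w ⟩
    ∑[ i < m ] deg subV-≟ (path i) w
      ≡⟨ sum-cong-≗ (λ i → deg-chain subV-≟ k (λ j → inj₂ (i , j)) (inj₁ (b i)) w refl) ⟩
    ∑[ i < m ] (2 * ∑[ j < suc k ] δ subV-≟ (inj₂ (i , j)) w)
      ≡⟨ sum-cong-≗ (λ i → cong (2 *_) (∑-δ-inner i i₀ j₀)) ⟩
    ∑[ i < m ] (2 * δ _≟_ i i₀)
      ≡⟨ sym (*-distribˡ-sum 2 (λ i → δ _≟_ i i₀)) ⟩
    2 * ∑[ i < m ] δ _≟_ i i₀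
      ≡⟨ cong (2 *_) (∑-δ i₀) ⟩
    2 ∎
    where
    open ≡-Reasoning
    w = inj₂ (i₀ , j₀)

  module _ (H : ℕ → ℕ → ℕ) where
    private
      F : SubV n m (suc k) × SubV n m (suc k) → ℕ
      F e = H (Dₛ (proj₁ e)) (Dₛ (proj₂ e))

      sum-chain : ∀ k′ (c : Fin (suc k′) → Fin m × Fin (suc k)) v →
        sum (map F (chain k′ (inj₂ ∘ c) (inj₁ v))) ≡ k′ * H 2 2 + H 2 (D v)
      sum-chain zero     c v = trans (ℕP.+-identityʳ _) (cong₂ H (deg-new (c zero)) (deg-old v))
      sum-chain (suc k′) c v =
        trans (cong₂ _+_ (cong₂ H (deg-new (c zero)) (deg-new (c (suc zero)))) (sum-chain k′ (c ∘ suc) v))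
              (sym (ℕP.+-assoc (H 2 2) _ _))

    sum-edges : sum (map F Eₛ) ≡ ∑[ i < m ] (H (D (a i)) 2 + (k * H 2 2 + H 2 (D (b i))))
    sum-edges = trans (sum-map-concatMap-tabulate F path id)
      (sum-cong-≗ (λ i → cong₂ _+_ (cong₂ H (deg-old (a i)) (deg-new (i , zero))) (sum-chain k (i ,_) (b i))))

  length-subdivision : length Eₛ ≡ m * (2 + k)
  length-subdivision = begin
    length Eₛ                       ≡⟨ sym (ℕP.*-identityʳ (length Eₛ)) ⟩
    length Eₛ * 1                   ≡⟨ sym (sum-map-const 1 Eₛ) ⟩
    sum (map (λ _ → 1) Eₛ)          ≡⟨ sum-edges (λ _ _ → 1) ⟩
    ∑[ i < m ] (1 + (k * 1 + 1))    ≡⟨ ∑-const m _ ⟩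
    m * (1 + (k * 1 + 1))           ≡⟨ cong (m *_) (count k) ⟩
    m * (2 + k)                     ∎
    where
    open ≡-Reasoning
    count : ∀ k → 1 + (k * 1 + 1) ≡ 2 + k
    count = solve-∀

  sum-subdivision : ∀ (H G : ℕ → ℕ → ℕ) c → (∀ x y → H x 2 + (k * H 2 2 + H 2 y) ≡ G x y + c) →
    sum (map (λ e → H (Dₛ (proj₁ e)) (Dₛ (proj₂ e))) Eₛ)
      ≡ sum (map (λ e → G (D (proj₁ e)) (D (proj₂ e))) E) + m * c
  sum-subdivision H G c split = begin
    sum (map (λ e → H (Dₛ (proj₁ e)) (Dₛ (proj₂ e))) Eₛ)
      ≡⟨ sum-edges H ⟩
    ∑[ i < m ] (H (D (a i)) 2 + (k * H 2 2 + H 2 (D (b i))))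
      ≡⟨ sum-cong-≗ (λ i → split (D (a i)) (D (b i))) ⟩
    ∑[ i < m ] (G (D (a i)) (D (b i)) + c)
      ≡⟨ ∑-distrib-+ (λ i → G (D (a i)) (D (b i))) (λ _ → c) ⟩
    ∑[ i < m ] G (D (a i)) (D (b i)) + ∑[ i < m ] c
      ≡⟨ cong₂ _+_ (sym (sum-map≡∑-lookup (λ e → G (D (proj₁ e)) (D (proj₂ e))) E)) (∑-const m c) ⟩
    sum (map (λ e → G (D (proj₁ e)) (D (proj₂ e))) E) + m * c ∎
    where open ≡-Reasoning

  sumEnds-subdivision : sumEnds subV-≟ Eₛ ≡ sumEnds _≟_ E + m * (4 * suc k)
  sumEnds-subdivision = sum-subdivision _+_ _+_ (4 * suc k) (λ x y → split x y k)
    where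
    split : ∀ x y k → (x + 2) + (k * 4 + (2 + y)) ≡ (x + y) + 4 * suc k
    split = solve-∀

  sumProd-subdivision : sumProd subV-≟ Eₛ ≡ 2 * sumEnds _≟_ E + m * (4 * k)
  sumProd-subdivision = trans (sum-subdivision _*_ (λ x y → 2 * (x + y)) (4 * k) (λ x y → split x y k))
                              (cong (_+ m * (4 * k)) (sum-map-* 2 (λ e → D (proj₁ e) + D (proj₂ e)) E))
    where
    split : ∀ x y k → x * 2 + (k * 4 + 2 * y) ≡ 2 * (x + y) + 4 * k
    split = solve-∀

  sumSq-subdivision : sumSq subV-≟ Eₛ ≡ sumSq _≟_ E + m * (8 * suc k)
  sumSq-subdivision = sum-subdivision (λ x y → x * x + y * y) (λ x y → x * x + y * y) (8 * suc k) (λ x y → split x y k)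
    where
    split : ∀ x y k → (x * x + 4) + (k * 8 + (4 + y * y)) ≡ (x * x + y * y) + 8 * suc k
    split = solve-∀

-- ℤ's +_ is opened only here, since elsewhere it makes ℕ sections such as (c +_) ambiguous.
module _ where
  open import Data.Integer using (+_)

  ⟦_⟧ : ℕ → ℚ
  ⟦ a ⟧ = + a / 1

  fromℚᵘ-homo-+ : ∀ x y → fromℚᵘ (x ℚᵘ.+ y) ≡ fromℚᵘ x ℚ.+ fromℚᵘ y
  fromℚᵘ-homo-+ x y = ℚP.toℚᵘ-injective (ℚᵘP.≃-trans (ℚP.toℚᵘ-fromℚᵘ (x ℚᵘ.+ y)) (ℚᵘP.≃-sym
    (ℚᵘP.≃-trans (ℚP.toℚᵘ-homo-+ (fromℚᵘ x) (fromℚᵘ y))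
                 (ℚᵘP.+-cong (ℚP.toℚᵘ-fromℚᵘ x) (ℚP.toℚᵘ-fromℚᵘ y)))))

  fromℚᵘ-homo-* : ∀ x y → fromℚᵘ (x ℚᵘ.* y) ≡ fromℚᵘ x ℚ.* fromℚᵘ y
  fromℚᵘ-homo-* x y = ℚP.toℚᵘ-injective (ℚᵘP.≃-trans (ℚP.toℚᵘ-fromℚᵘ (x ℚᵘ.* y)) (ℚᵘP.≃-sym
    (ℚᵘP.≃-trans (ℚP.toℚᵘ-homo-* (fromℚᵘ x) (fromℚᵘ y))
                 (ℚᵘP.*-cong (ℚP.toℚᵘ-fromℚᵘ x) (ℚP.toℚᵘ-fromℚᵘ y)))))

  ⟦⟧-homo-+ : ∀ a b → ⟦ a + b ⟧ ≡ ⟦ a ⟧ ℚ.+ ⟦ b ⟧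
  ⟦⟧-homo-+ a b = trans (cong (λ z → fromℚᵘ (mkℚᵘ z 0)) numerator-eq)
                        (fromℚᵘ-homo-+ (mkℚᵘ (+ a) 0) (mkℚᵘ (+ b) 0))
    where
    numerator-eq : + (a + b) ≡ + a ℤ.* + 1 ℤ.+ + b ℤ.* + 1
    numerator-eq = trans (ℤP.pos-+ a b) (sym (cong₂ ℤ._+_ (ℤP.*-identityʳ (+ a)) (ℤP.*-identityʳ (+ b))))

  ⟦⟧-homo-* : ∀ a b → ⟦ a * b ⟧ ≡ ⟦ a ⟧ ℚ.* ⟦ b ⟧
  ⟦⟧-homo-* a b = trans (cong (λ z → fromℚᵘ (mkℚᵘ z 0)) (ℤP.pos-* a b))
                        (fromℚᵘ-homo-* (mkℚᵘ (+ a) 0) (mkℚᵘ (+ b) 0))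

  1/n*n≡1 : ∀ n → (+ 1 / suc n) ℚ.* ⟦ suc n ⟧ ≡ 1ℚ
  1/n*n≡1 n = trans (sym (fromℚᵘ-homo-* (mkℚᵘ (+ 1) n) (mkℚᵘ (+ suc n) 0)))
                    (ℚP.fromℚᵘ-cong (ℚᵘP.*-inverseˡ (mkℚᵘ (+ suc n) 0)))

  -- The edge list is taken in the form e ∷ es so that invm computes to 1 / M.
  module _ {V : Set} (_≟_ : DecidableEquality V) (e : V × V) (es : List (V × V)) (μ : ℕ) where
    open +-*-Solver using (solve; _:=_; con; _:+_; _:*_; _:-_)
    open ≡-Reasoning

    private
      E = e ∷ es
      M = length E
      ½ = + 1 / 2
      1/M = + 1 / M
      1/M*M≡1 : 1/M ℚ.* ⟦ M ⟧ ≡ 1ℚ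
      1/M*M≡1 = 1/n*n≡1 (length es)
      μ² = ⟦ μ ⟧ ℚ.* ⟦ μ ⟧

    meanEnds≡μ : sumEnds _≟_ E ≡ 2 * μ * M → meanEnds _≟_ E ≡ ⟦ μ ⟧
    meanEnds≡μ ends = begin
      1/M ℚ.* (½ ℚ.* ⟦ sumEnds _≟_ E ⟧)          ≡⟨ cong (λ x → 1/M ℚ.* (½ ℚ.* x)) ends-ℚ ⟩
      1/M ℚ.* (½ ℚ.* ((⟦ 2 ⟧ ℚ.* ⟦ μ ⟧) ℚ.* ⟦ M ⟧))
        ≡⟨ solve 3 (λ q N x → q :* (con ½ :* ((con ⟦ 2 ⟧ :* x) :* N)) := (q :* N) :* x)
                 refl 1/M ⟦ M ⟧ ⟦ μ ⟧ ⟩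
      (1/M ℚ.* ⟦ M ⟧) ℚ.* ⟦ μ ⟧                  ≡⟨ cong (ℚ._* ⟦ μ ⟧) 1/M*M≡1 ⟩
      1ℚ ℚ.* ⟦ μ ⟧                               ≡⟨ ℚP.*-identityˡ ⟦ μ ⟧ ⟩
      ⟦ μ ⟧                                      ∎
      where
      ends-ℚ : ⟦ sumEnds _≟_ E ⟧ ≡ (⟦ 2 ⟧ ℚ.* ⟦ μ ⟧) ℚ.* ⟦ M ⟧
      ends-ℚ = trans (cong ⟦_⟧ ends) (trans (⟦⟧-homo-* (2 * μ) M) (cong (ℚ._* ⟦ M ⟧) (⟦⟧-homo-* 2 μ)))

    numer≡0 : meanEnds _≟_ E ≡ ⟦ μ ⟧ → sumProd _≟_ E ≡ μ * μ * M → numer _≟_ E ≡ 0ℚ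
    numer≡0 mean prod = begin
      1/M ℚ.* ⟦ sumProd _≟_ E ⟧ ℚ.- meanEnds _≟_ E ℚ.* meanEnds _≟_ E
        ≡⟨ cong₂ (λ x y → 1/M ℚ.* x ℚ.- y ℚ.* y) prod-ℚ mean ⟩
      1/M ℚ.* (μ² ℚ.* ⟦ M ⟧) ℚ.- μ²
        ≡⟨ solve 3 (λ q N x → q :* (x :* N) :- x := (q :* N) :* x :- x) refl 1/M ⟦ M ⟧ μ² ⟩
      (1/M ℚ.* ⟦ M ⟧) ℚ.* μ² ℚ.- μ²
        ≡⟨ cong (λ x → x ℚ.* μ² ℚ.- μ²) 1/M*M≡1 ⟩
      1ℚ ℚ.* μ² ℚ.- μ²
        ≡⟨ solve 1 (λ x → con 1ℚ :* x :- x := con 0ℚ) refl μ² ⟩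
      0ℚ ∎
      where
      prod-ℚ : ⟦ sumProd _≟_ E ⟧ ≡ μ² ℚ.* ⟦ M ⟧
      prod-ℚ = trans (cong ⟦_⟧ prod) (trans (⟦⟧-homo-* (μ * μ) M) (cong (ℚ._* ⟦ M ⟧) (⟦⟧-homo-* μ μ)))

    denom≡ : meanEnds _≟_ E ≡ ⟦ μ ⟧ → ∀ r → sumSq _≟_ E ≡ 2 * (μ * μ) * M + r →
             denom _≟_ E ≡ 1/M ℚ.* (½ ℚ.* ⟦ r ⟧)
    denom≡ mean r sq = begin
      1/M ℚ.* (½ ℚ.* ⟦ sumSq _≟_ E ⟧) ℚ.- meanEnds _≟_ E ℚ.* meanEnds _≟_ E
        ≡⟨ cong₂ (λ x y → 1/M ℚ.* (½ ℚ.* x) ℚ.- y ℚ.* y) sq-ℚ mean ⟩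
      1/M ℚ.* (½ ℚ.* ((⟦ 2 ⟧ ℚ.* μ²) ℚ.* ⟦ M ⟧ ℚ.+ ⟦ r ⟧)) ℚ.- μ²
        ≡⟨ solve 4 (λ q N x y → q :* (con ½ :* ((con ⟦ 2 ⟧ :* x) :* N :+ y)) :- x
                               := (q :* N) :* x :+ q :* (con ½ :* y) :- x) refl 1/M ⟦ M ⟧ μ² ⟦ r ⟧ ⟩
      (1/M ℚ.* ⟦ M ⟧) ℚ.* μ² ℚ.+ ρ ℚ.- μ²
        ≡⟨ cong (λ x → x ℚ.* μ² ℚ.+ ρ ℚ.- μ²) 1/M*M≡1 ⟩
      1ℚ ℚ.* μ² ℚ.+ ρ ℚ.- μ²
        ≡⟨ solve 2 (λ x y → con 1ℚ :* x :+ y :- x := y) refl μ² ρ ⟩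
      ρ ∎
      where
      ρ = 1/M ℚ.* (½ ℚ.* ⟦ r ⟧)
      sq-ℚ : ⟦ sumSq _≟_ E ⟧ ≡ (⟦ 2 ⟧ ℚ.* μ²) ℚ.* ⟦ M ⟧ ℚ.+ ⟦ r ⟧
      sq-ℚ = trans (cong ⟦_⟧ sq) (trans (⟦⟧-homo-+ (2 * (μ * μ) * M) r) (cong (ℚ._+ ⟦ r ⟧)
        (trans (⟦⟧-homo-* (2 * (μ * μ)) M) (cong (ℚ._* ⟦ M ⟧)
          (trans (⟦⟧-homo-* 2 (μ * μ)) (cong (⟦ 2 ⟧ ℚ.*_) (⟦⟧-homo-* μ μ)))))))

  neutral-if-mean-degree : ∀ {V : Set} (_≟_ : DecidableEquality V) (E : List (V × V)) (μ : ℕ) →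
    sumEnds _≟_ E ≡ 2 * μ * length E → sumProd _≟_ E ≡ μ * μ * length E →
    2 * (μ * μ) * length E < sumSq _≟_ E → Neutral _≟_ E
  neutral-if-mean-degree _≟_ []         μ _    _    ()
  neutral-if-mean-degree _≟_ E@(e ∷ es) μ ends prod sq = s≤s z≤n , denom-nonZero , assortativity≡0
    where
    mean = meanEnds≡μ _≟_ e es μ ends
    r = sumSq _≟_ E ℕ.∸ 2 * (μ * μ) * length E
    instance
      r-nonZero : ℕ.NonZero r
      r-nonZero = ℕ.>-nonZero (ℕP.m<n⇒0<n∸m sq)
    denom-positive : ℚ.Positive (denom _≟_ E)
    denom-positive = subst ℚ.Positive (sym (denom≡ _≟_ e es μ mean r (sym (ℕP.m+[n∸m]≡n (ℕP.<⇒≤ sq)))))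
      (ℚP.pos*pos⇒pos (+ 1 / length E) {{ℚP.normalize-pos 1 (length E)}} (+ 1 / 2 ℚ.* ⟦ r ⟧)
        {{ℚP.pos*pos⇒pos (+ 1 / 2) ⟦ r ⟧ {{ℚP.normalize-pos r 1}}}})
    denom-nonZero : ℚ.NonZero (denom _≟_ E)
    denom-nonZero = ℚP.pos⇒nonZero (denom _≟_ E) {{denom-positive}}
    assortativity≡0 : assortativity _≟_ E {{denom-nonZero}} ≡ 0ℚ
    assortativity≡0 = trans (cong (λ x → ℚ._÷_ x (denom _≟_ E) {{denom-nonZero}}) (numer≡0 _≟_ e es μ mean prod))
                            (ℚP.*-zeroˡ ((ℚ.1/ denom _≟_ E) {{denom-nonZero}}))

theorem1 : (n : ℕ) (E : List (Fin n × Fin n)) → IsTree E → 1 ≤ length E →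
           sumEnds _≟_ E ≡ 4 * length E →
           (s : ℕ) → 1 ≤ s → Neutral subV-≟ (subdivision s E)
theorem1 n E _                       _   _    zero    ()
theorem1 n E (_ , connected , m+1≡n) 1≤m ends (suc k) _ =
  neutral-if-mean-degree subV-≟ Eₛ 2 endsₛ prodₛ sqₛ
  where
  open Subdivision E k
  m  = length E
  Eₛ = subdivision (suc k) E

  ends-count : ∀ m k → 4 * m + m * (4 * suc k) ≡ 4 * (m * (2 + k))
  ends-count = solve-∀
  prod-count : ∀ m k → 2 * (4 * m) + m * (4 * k) ≡ 4 * (m * (2 + k))
  prod-count = solve-∀
  sq-count : ∀ m k → 8 * (m * (2 + k)) ≡ 8 * m + m * (8 * suc k)
  sq-count = solve-∀

  endsₛ : sumEnds subV-≟ Eₛ ≡ 2 * 2 * length Eₛ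
  endsₛ = trans sumEnds-subdivision (trans (cong (_+ m * (4 * suc k)) ends)
            (trans (ends-count m k) (cong (4 *_) (sym length-subdivision))))

  prodₛ : sumProd subV-≟ Eₛ ≡ 2 * 2 * length Eₛ
  prodₛ = trans sumProd-subdivision (trans (cong (λ x → 2 * x + m * (4 * k)) ends)
            (trans (prod-count m k) (cong (4 *_) (sym length-subdivision))))

  sqₛ : 2 * (2 * 2) * length Eₛ < sumSq subV-≟ Eₛ
  sqₛ = begin-strict
    8 * length Eₛ                   ≡⟨ trans (cong (8 *_) length-subdivision) (sq-count m k) ⟩
    8 * m + m * (8 * suc k)         <⟨ ℕP.+-monoˡ-< (m * (8 * suc k)) (tree-sumSq-bound E connected m+1≡n 1≤m ends) ⟩
    sumSq _≟_ E + m * (8 * suc k)   ≡⟨ sym sumSq-subdivision ⟩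
    sumSq subV-≟ Eₛ                 ∎
    where open ℕP.≤-Reasoning
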